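{- Let $n$ be a positive integer and suppose $S=\{s_1<\cdots<s_r\}$ (with $r\ge1$) is $n$-admissible. Let $S_1=S\setminus\{s_r\}$, $k=s_r-1$, and $S_2=S_1\cup\{k\}$. Then \[ P_S(n,q)=\begin{bmatrix} n\\ k\end{bmatrix}_q\cdot P_{S_1}(k,q)\cdot(-q;q)_{n-k-1}-P_{S_1}(n,q)-P_{S_2}(n,q). \]
   Context: For $\pi\in\mathfrak{S}_m$, $\ell(\pi)$ is the number of inversions and $\mathrm{Peak}(\pi)=\{i\in\{2,\ldots,m-1\}:\pi_{i-1}<\pi_i>\pi_{i+1}\}$. For any finite set $U$ of positive integers, $P_U(m,q)=\sum_{\pi\in\mathfrak{S}_m,\ \mathrm{Peak}(\pi)=U}q^{\ell(\pi)}$ (which is $0$ if no such $\pi$ exists). $S$ is $n$-admissible if $S=\mathrm{Peak}(\pi)$ for some $\pi\in\mathfrak{S}_n$. $(-q;q)_j=\prod_{i=1}^j(1+q^i)$, and $\begin{bmatrix} n\\ k\end{bmatrix}_q=\frac{[n]!_q}{[k]!_q[n-k]!_q}$ with $[j]!_q=\prod_{i=1}^j(1+q+\cdots+q^{i-1})$. -}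

module Defs where

open import Data.Nat using (ℕ; zero; suc; _+_; _*_; _∸_; _^_; _<ᵇ_; _≡ᵇ_; NonZero)
open import Data.Nat.ListAction using (sum)
open import Data.Nat.DivMod using (_/_)
open import Data.Nat.Properties using (m*n≢0)
open import Data.Bool using (Bool; true; false; _∧_; _∨_; if_then_else_)
open import Relation.Binary.PropositionalEquality using (_≡_)
open import Data.List.Membership.Propositional using (_∈_)
open import Data.List using (List; []; _∷_; map; concatMap; length; filterᵇ)
open import Data.Bool.ListAction using (all)

insertEverywhere : ℕ → List ℕ → List (List ℕ)
insertEverywhere x []       = (x ∷ []) ∷ []
insertEverywhere x (y ∷ ys) = (x ∷ y ∷ ys) ∷ map (y ∷_) (insertEverywhere x ys)

-- perms m = list of all elements of 𝔖_m (each exactly once), as words π₁ … π_m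
perms : ℕ → List (List ℕ)
perms zero    = [] ∷ []
perms (suc m) = concatMap (insertEverywhere (suc m)) (perms m)

inv : List ℕ → ℕ
inv []       = 0
inv (x ∷ xs) = length (filterᵇ (λ y → y <ᵇ x) xs) + inv xs

-- peaks with positions counted starting from the index i of the second letter
peaksFrom : ℕ → List ℕ → List ℕ
peaksFrom i (a ∷ b ∷ c ∷ rest) =
  (if (a <ᵇ b) ∧ (c <ᵇ b) then i ∷ [] else [])
  Data.List.++ peaksFrom (suc i) (b ∷ c ∷ rest)
peaksFrom i _ = []

-- Peak(π) = { i ∈ {2,…,m-1} : π_{i-1} < π_i > π_{i+1} } (positions 1-indexed)
Peak : List ℕ → List ℕ
Peak π = peaksFrom 2 π

memb : ℕ → List ℕ → Bool
memb x []       = false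
memb x (y ∷ ys) = (x ≡ᵇ y) ∨ memb x ys

sameSetᵇ : List ℕ → List ℕ → Bool
sameSetᵇ A B = all (λ x → memb x B) A ∧ all (λ x → memb x A) B

P : List ℕ → ℕ → ℕ → ℕ
P U m q = sum (map (λ π → if sameSetᵇ (Peak π) U then q ^ inv π else 0) (perms m))

data Admissible (n : ℕ) (S : List ℕ) : Set where
  admissible : (π : List ℕ) → π ∈ perms n → sameSetᵇ (Peak π) S ≡ true → Admissible n S

qint : ℕ → ℕ → ℕ
qint q zero    = 0
qint q (suc j) = 1 + q * qint q j

qfact : ℕ → ℕ → ℕ
qfact q zero    = 1
qfact q (suc j) = qint q (suc j) * qfact q j

qint-suc-nz : ∀ q j → NonZero (qint q (suc j))
qint-suc-nz q j = _

qfact-nz : ∀ q j → NonZero (qfact q j)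
qfact-nz q zero    = _
qfact-nz q (suc j) = m*n≢0 (qint q (suc j)) (qfact q j) {{qint-suc-nz q j}} {{qfact-nz q j}}

-- q-binomial [n k]_q = [n]!_q / ([k]!_q [n-k]!_q)   (for k ≤ n)
qbinom : ℕ → ℕ → ℕ → ℕ
qbinom q n k = (qfact q n / (qfact q k * qfact q (n ∸ k)))
  {{m*n≢0 (qfact q k) (qfact q (n ∸ k)) {{qfact-nz q k}} {{qfact-nz q (n ∸ k)}}}}

negqPoch : ℕ → ℕ → ℕ
negqPoch q zero    = 1
negqPoch q (suc j) = negqPoch q j * (1 + q ^ suc j)

-- Split π ∈ 𝔖_n as σ ++ τ with |σ| = k = s − 1. Away from the positions k and k + 1, the peaks of π are
-- those of σ together with those of τ shifted by k, and k, k + 1 are never both peaks. Hence each π with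
-- Peak σ = S₁ and τ peakless is counted by exactly one of the three sums on the left (according to which of
-- k, k + 1 is a peak), and no other π is counted. Its weight factors as q^inv π = q^cross(σ,τ) q^inv σ q^inv τ,
-- and the factors q^inv σ, q^inv τ only depend on the relative orders within σ and τ; summing q^cross over the
-- shuffles with prescribed relative orders gives [n k]_q. Finally, the peakless permutations of m + 1 letters
-- have generating function (−q;q)_m: the letter m + 1 can only be placed first (adding q^m inversions) or last.

module Submission where

open import Defs
open import Data.Bool using (Bool; true; false; _∧_; _∨_; not; if_then_else_; T)
open import Data.Bool.ListAction using (all)
open import Data.Bool.Properties using (∨-identityʳ; ∨-zeroʳ; ∧-zeroʳ; ∧-identityʳ; ∨-assoc)
open import Data.Empty using (⊥; ⊥-elim)
open import Data.Sum using (inj₁; inj₂)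
open import Data.List using (List; []; _∷_; _++_; map; concatMap; length; filterᵇ; take; drop)
open import Data.List.Properties using (map-++; map-∘; length-++; length-take; length-drop; take++drop≡id; ++-assoc; ++-identityʳ)
open import Data.List.Relation.Unary.All as All using (All; []; _∷_)
open import Data.List.Relation.Binary.Pointwise as Pointwise using (Pointwise; []; _∷_)
open import Data.List.Relation.Unary.All.Properties using (++⁻ˡ; ++⁻ʳ; map⁺; concat⁺)
open import Data.Nat using (ℕ; zero; suc; _+_; _*_; _∸_; _^_; _≤_; _<_; _<ᵇ_; _≡ᵇ_; z≤n; s≤s; z<s; s<s; NonZero; _/_)
open import Data.Nat.DivMod using (m*n/n≡m)
open import Data.Nat.ListAction using (sum)
open import Data.Nat.ListAction.Properties using (sum-++)
open import Data.Nat.Properties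
open import Data.List.Extrema.Nat using (max; xs≤max)
open import Data.List.Relation.Unary.Linked as Linked using (Linked; [-]; _∷_)
open import Data.Nat.Tactic.RingSolver using (solve-∀)
open import Data.Product using (_×_; _,_; proj₁; swap)
open import Function using (_∘_; _⇔_; mk⇔; Equivalence)
open import Relation.Binary.PropositionalEquality

∑ : {A : Set} → List A → (A → ℕ) → ℕ
∑ xs f = sum (map f xs)

∑-++ : ∀ {A : Set} (xs ys : List A) f → ∑ (xs ++ ys) f ≡ ∑ xs f + ∑ ys f
∑-++ xs ys f = trans (cong sum (map-++ f xs ys)) (sum-++ (map f xs) (map f ys))

∑-concatMap : ∀ {A B : Set} (h : A → List B) (xs : List A) f →
              ∑ (concatMap h xs) f ≡ ∑ xs (λ x → ∑ (h x) f)
∑-concatMap h []       f = refl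
∑-concatMap h (x ∷ xs) f = trans (∑-++ (h x) (concatMap h xs) f) (cong (∑ (h x) f +_) (∑-concatMap h xs f))

∑-map : ∀ {A B : Set} (g : B → A) (xs : List B) f → ∑ (map g xs) f ≡ ∑ xs (f ∘ g)
∑-map g xs f = cong sum (sym (map-∘ xs))

∑-congᴬ : ∀ {A : Set} {xs : List A} {f g} → All (λ x → f x ≡ g x) xs → ∑ xs f ≡ ∑ xs g
∑-congᴬ []       = refl
∑-congᴬ (e ∷ es) = cong₂ _+_ e (∑-congᴬ es)

∑-cong : ∀ {A : Set} (xs : List A) {f g} → (∀ x → f x ≡ g x) → ∑ xs f ≡ ∑ xs g
∑-cong []       e = refl
∑-cong (x ∷ xs) e = cong₂ _+_ (e x) (∑-cong xs e)

∑-zero : ∀ {A : Set} {xs : List A} f → All (λ x → f x ≡ 0) xs → ∑ xs f ≡ 0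
∑-zero f []       = refl
∑-zero f (e ∷ es) = cong₂ _+_ e (∑-zero f es)

∑-*ˡ : ∀ {A : Set} (xs : List A) c f → ∑ xs (λ x → c * f x) ≡ c * ∑ xs f
∑-*ˡ []       c f = sym (*-zeroʳ c)
∑-*ˡ (x ∷ xs) c f = trans (cong (c * f x +_) (∑-*ˡ xs c f)) (sym (*-distribˡ-+ c (f x) _))

∑-distrib-+ : ∀ {A : Set} (xs : List A) f g → ∑ xs (λ x → f x + g x) ≡ ∑ xs f + ∑ xs g
∑-distrib-+ []       f g = refl
∑-distrib-+ (x ∷ xs) f g = trans (cong (f x + g x +_) (∑-distrib-+ xs f g)) (+-shuffle (f x) (g x) _ _)
  where
  +-shuffle : ∀ a b c d → a + b + (c + d) ≡ a + c + (b + d)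
  +-shuffle = solve-∀

Word : ℕ → List ℕ → Set
Word n π = length π ≡ n × All (_≤ n) π

insertEverywhere-length : ∀ x u → All (λ w → length w ≡ suc (length u)) (insertEverywhere x u)
insertEverywhere-length x []      = refl ∷ []
insertEverywhere-length x (y ∷ u) = refl ∷ map⁺ (All.map (cong suc) (insertEverywhere-length x u))

insertEverywhere-All : ∀ {P : ℕ → Set} {x u} → P x → All P u → All (All P) (insertEverywhere x u)
insertEverywhere-All px []         = (px ∷ []) ∷ []
insertEverywhere-All px (py ∷ pu) = (px ∷ py ∷ pu) ∷ map⁺ (All.map (py ∷_) (insertEverywhere-All px pu))

perms-Word : ∀ n → All (Word n) (perms n)
perms-Word zero    = (refl , []) ∷ []
perms-Word (suc n) = concat⁺ (map⁺ (All.map extend (perms-Word n)))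
  where
  extend : ∀ {π} → Word n π → All (Word (suc n)) (insertEverywhere (suc n) π)
  extend {π} (len , bnd) =
    All.zipWith (λ (l , b) → trans l (cong suc len) , b)
      (insertEverywhere-length (suc n) π , insertEverywhere-All ≤-refl (All.map m≤n⇒m≤1+n bnd))

take-++ : ∀ {A : Set} (u v : List A) → take (length u) (u ++ v) ≡ u
take-++ []      v = refl
take-++ (a ∷ u) v = cong (a ∷_) (take-++ u v)

drop-++ : ∀ {A : Set} (u v : List A) → drop (length u) (u ++ v) ≡ v
drop-++ []      v = refl
drop-++ (a ∷ u) v = drop-++ u v

insertEverywhere-++ : ∀ x u y ρ → insertEverywhere x (u ++ y ∷ ρ) ≡
  map (_++ y ∷ ρ) (insertEverywhere x u) ++ map ((u ++ y ∷ []) ++_) (insertEverywhere x ρ)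
insertEverywhere-++ x []      y ρ = refl
insertEverywhere-++ x (a ∷ u) y ρ = cong ((x ∷ a ∷ u ++ y ∷ ρ) ∷_) (begin
  map (a ∷_) (insertEverywhere x (u ++ y ∷ ρ))
    ≡⟨ cong (map (a ∷_)) (insertEverywhere-++ x u y ρ) ⟩
  map (a ∷_) (map (_++ y ∷ ρ) L ++ map ((u ++ y ∷ []) ++_) R)
    ≡⟨ map-++ (a ∷_) (map (_++ y ∷ ρ) L) _ ⟩
  map (a ∷_) (map (_++ y ∷ ρ) L) ++ map (a ∷_) (map ((u ++ y ∷ []) ++_) R)
    ≡⟨ cong₂ _++_ (trans (sym (map-∘ L)) (map-∘ L)) (sym (map-∘ R)) ⟩
  map (_++ y ∷ ρ) (map (a ∷_) L) ++ map ((a ∷ u ++ y ∷ []) ++_) R ∎)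
  where
  open ≡-Reasoning
  L = insertEverywhere x u
  R = insertEverywhere x ρ

-- Inversions

<⇒<ᵇ≡true : ∀ {m n} → m < n → (m <ᵇ n) ≡ true
<⇒<ᵇ≡true {zero}  {suc n} _       = refl
<⇒<ᵇ≡true {suc m} {suc n} (s≤s p) = <⇒<ᵇ≡true p

≥⇒<ᵇ≡false : ∀ {m n} → n ≤ m → (m <ᵇ n) ≡ false
≥⇒<ᵇ≡false {m}     {zero}  _       = refl
≥⇒<ᵇ≡false {suc m} {suc n} (s≤s p) = ≥⇒<ᵇ≡false p

below : ℕ → List ℕ → ℕ
below a []      = 0
below a (b ∷ v) = (if b <ᵇ a then 1 else 0) + below a v

inv-∷ : ∀ x xs → inv (x ∷ xs) ≡ below x xs + inv xs
inv-∷ x xs = cong (_+ inv xs) (length-filter xs)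
  where
  length-filter : ∀ v → length (filterᵇ (_<ᵇ x) v) ≡ below x v
  length-filter []      = refl
  length-filter (b ∷ v) with b <ᵇ x
  ... | true  = cong suc (length-filter v)
  ... | false = length-filter v

below-++ : ∀ a u v → below a (u ++ v) ≡ below a u + below a v
below-++ a []      v = refl
below-++ a (b ∷ u) v = trans (cong (_ +_) (below-++ a u v)) (sym (+-assoc (if b <ᵇ a then 1 else 0) _ _))

below≡length : ∀ {x} v → All (_< x) v → below x v ≡ length v
below≡length []      []       = refl
below≡length (b ∷ v) (p ∷ ps) rewrite <⇒<ᵇ≡true p = cong suc (below≡length v ps)

crossInv : List ℕ → List ℕ → ℕ
crossInv []      v = 0
crossInv (a ∷ u) v = below a v + crossInv u v

inv-++ : ∀ u v → inv (u ++ v) ≡ crossInv u v + (inv u + inv v)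
inv-++ []      v = refl
inv-++ (a ∷ u) v = begin
  inv (a ∷ u ++ v)                                  ≡⟨ inv-∷ a (u ++ v) ⟩
  below a (u ++ v) + inv (u ++ v)                   ≡⟨ cong₂ _+_ (below-++ a u v) (inv-++ u v) ⟩
  (below a u + below a v) + (crossInv u v + (inv u + inv v))
                                                    ≡⟨ regroup (below a u) (below a v) (crossInv u v) (inv u) (inv v) ⟩
  crossInv (a ∷ u) v + ((below a u + inv u) + inv v) ≡⟨ cong (λ z → crossInv (a ∷ u) v + (z + inv v)) (sym (inv-∷ a u)) ⟩
  crossInv (a ∷ u) v + (inv (a ∷ u) + inv v)        ∎
  where
  open ≡-Reasoning
  regroup : ∀ p q r s t → (p + q) + (r + (s + t)) ≡ (q + r) + ((p + s) + t)
  regroup = solve-∀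

crossInv-[] : ∀ u → crossInv u [] ≡ 0
crossInv-[] []      = refl
crossInv-[] (a ∷ u) = crossInv-[] u

below-insertEverywhere : ∀ {a x} → a < x → ∀ ρ → All (λ w → below a w ≡ below a ρ) (insertEverywhere x ρ)
below-insertEverywhere {a} {x} a<x ρ = go ρ
  where
  x≮a : (x <ᵇ a) ≡ false
  x≮a = ≥⇒<ᵇ≡false (<⇒≤ a<x)
  go : ∀ ρ → All (λ w → below a w ≡ below a ρ) (insertEverywhere x ρ)
  go []      = cong (λ b → (if b then 1 else 0) + 0) x≮a ∷ []
  go (b ∷ ρ) = cong (λ c → (if c then 1 else 0) + below a (b ∷ ρ)) x≮a
             ∷ map⁺ (All.map (cong ((if b <ᵇ a then 1 else 0) +_)) (go ρ))

crossInv-insertEverywhereʳ : ∀ {x} u → All (_< x) u → ∀ ρ →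
  All (λ w → crossInv u w ≡ crossInv u ρ) (insertEverywhere x ρ)
crossInv-insertEverywhereʳ []      []       ρ = All.map (λ _ → refl) (insertEverywhere-length _ ρ)
crossInv-insertEverywhereʳ (a ∷ u) (p ∷ ps) ρ =
  All.zipWith (λ (e , f) → cong₂ _+_ e f)
    (below-insertEverywhere p ρ , crossInv-insertEverywhereʳ u ps ρ)

crossInv-insertEverywhereˡ : ∀ x u v → All (λ w → crossInv w v ≡ below x v + crossInv u v) (insertEverywhere x u)
crossInv-insertEverywhereˡ x []      v = refl ∷ []
crossInv-insertEverywhereˡ x (b ∷ u) v =
  refl ∷ map⁺ (All.map (λ e → trans (cong (below b v +_) e) (exchange (below b v) (below x v) (crossInv u v)))
                       (crossInv-insertEverywhereˡ x u v))
  where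
  exchange : ∀ p q r → p + (q + r) ≡ q + (p + r)
  exchange = solve-∀

-- Order-isomorphic words

SameOrder : ℕ → ℕ → ℕ → ℕ → Set
SameOrder a b c d = ((c <ᵇ a) ≡ (d <ᵇ b)) × ((a <ᵇ c) ≡ (b <ᵇ d))

-- any two positions compare alike in u and in v
data _≅_ : List ℕ → List ℕ → Set where
  []  : [] ≅ []
  _∷_ : ∀ {a b u v} → Pointwise (SameOrder a b) u v → u ≅ v → (a ∷ u) ≅ (b ∷ v)

≅-refl : ∀ u → u ≅ u
≅-refl []      = []
≅-refl (a ∷ u) = Pointwise.refl (refl , refl) ∷ ≅-refl u

OrderInvariant : (List ℕ → ℕ) → Set
OrderInvariant f = ∀ {u v} → u ≅ v → f u ≡ f v

below-≅ : ∀ {a b u v} → Pointwise (SameOrder a b) u v → below a u ≡ below b v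
below-≅ []             = refl
below-≅ ((e , _) ∷ rs) = cong₂ (λ z w → (if z then 1 else 0) + w) e (below-≅ rs)

inv-≅ : ∀ {u v} → u ≅ v → inv u ≡ inv v
inv-≅ []                         = refl
inv-≅ {a ∷ u} {b ∷ v} (rs ∷ r) =
  trans (inv-∷ a u) (trans (cong₂ _+_ (below-≅ rs) (inv-≅ r)) (sym (inv-∷ b v)))

peaksFrom-≅ : ∀ {u v} → u ≅ v → ∀ i → peaksFrom i u ≡ peaksFrom i v
peaksFrom-≅ []                                             i = refl
peaksFrom-≅ ([] ∷ [])                                      i = refl
peaksFrom-≅ ((_ ∷ []) ∷ ([] ∷ []))                         i = refl
peaksFrom-≅ (((_ , e₁) ∷ _ ∷ _) ∷ r@(((e₂ , _) ∷ _) ∷ _)) i =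
  cong₂ (λ z w → (if z then i ∷ [] else []) ++ w) (cong₂ _∧_ e₁ e₂) (peaksFrom-≅ r (suc i))

Pointwise-zipWith : ∀ {A B : Set} {R S T : A → B → Set} → (∀ {x y} → R x y → S x y → T x y) →
  ∀ {xs ys} → Pointwise R xs ys → Pointwise S xs ys → Pointwise T xs ys
Pointwise-zipWith f []       []       = []
Pointwise-zipWith f (r ∷ rs) (s ∷ ss) = f r s ∷ Pointwise-zipWith f rs ss

sameOrder-above : ∀ {a b x y} → a < x → b < y → SameOrder x y a b
sameOrder-above a<x b<y =
  trans (<⇒<ᵇ≡true a<x) (sym (<⇒<ᵇ≡true b<y)) ,
  trans (≥⇒<ᵇ≡false (<⇒≤ a<x)) (sym (≥⇒<ᵇ≡false (<⇒≤ b<y)))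

insertEverywhere-SameOrder : ∀ {a b x y u v} → Pointwise (SameOrder a b) u v → SameOrder a b x y →
  Pointwise (Pointwise (SameOrder a b)) (insertEverywhere x u) (insertEverywhere y v)
insertEverywhere-SameOrder []       s = (s ∷ []) ∷ []
insertEverywhere-SameOrder (r ∷ rs) s =
  (s ∷ r ∷ rs) ∷ Pointwise.map⁺ _ _ (Pointwise.map (r ∷_) (insertEverywhere-SameOrder rs s))

above-SameOrder : ∀ {x y u v} → u ≅ v → All (_< x) u → All (_< y) v → Pointwise (SameOrder x y) u v
above-SameOrder []      []       []       = []
above-SameOrder (_ ∷ r) (p ∷ ps) (p′ ∷ ps′) = sameOrder-above p p′ ∷ above-SameOrder r ps ps′

insertEverywhere-≅ : ∀ {x y u v} → u ≅ v → All (_< x) u → All (_< y) v →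
  Pointwise _≅_ (insertEverywhere x u) (insertEverywhere y v)
insertEverywhere-≅ []            []       []         = ([] ∷ []) ∷ []
insertEverywhere-≅ r@(rs ∷ r′) (p ∷ ps) (p′ ∷ ps′) =
  (above-SameOrder r (p ∷ ps) (p′ ∷ ps′) ∷ r)
  ∷ Pointwise.map⁺ _ _
      (Pointwise-zipWith _∷_ (insertEverywhere-SameOrder rs (swap (sameOrder-above p p′))) (insertEverywhere-≅ r′ ps ps′))

∑-Pointwise : ∀ {A B : Set} {xs : List A} {ys : List B} (f : A → ℕ) (g : B → ℕ) →
  Pointwise (λ x y → f x ≡ g y) xs ys → ∑ xs f ≡ ∑ ys g
∑-Pointwise f g []       = refl
∑-Pointwise f g (e ∷ es) = cong₂ _+_ e (∑-Pointwise f g es)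

∑-insertEverywhere-≅ : ∀ {f} → OrderInvariant f → ∀ {x y u v} → u ≅ v → All (_< x) u → All (_< y) v →
  ∑ (insertEverywhere x u) f ≡ ∑ (insertEverywhere y v) f
∑-insertEverywhere-≅ {f} f-inv r p p′ = ∑-Pointwise f f (Pointwise.map f-inv (insertEverywhere-≅ r p p′))

below-max : ∀ u → All (_< suc (max 0 u)) u
below-max u = All.map s≤s (xs≤max 0 u)

liftMax : (List ℕ → ℕ) → List ℕ → ℕ
liftMax f u = ∑ (insertEverywhere (suc (max 0 u)) u) f

liftMax-invariant : ∀ {f} → OrderInvariant f → OrderInvariant (liftMax f)
liftMax-invariant f-inv {u} {v} r = ∑-insertEverywhere-≅ f-inv r (below-max u) (below-max v)

∑-insertEverywhere-above : ∀ {f} → OrderInvariant f → ∀ {x} u → All (_< x) u →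
  ∑ (insertEverywhere x u) f ≡ liftMax f u
∑-insertEverywhere-above f-inv u p = ∑-insertEverywhere-≅ f-inv (≅-refl u) p (below-max u)

∑-perms-suc : ∀ n f → OrderInvariant f → ∑ (perms (suc n)) f ≡ ∑ (perms n) (liftMax f)
∑-perms-suc n f f-inv = trans (∑-concatMap (insertEverywhere (suc n)) (perms n) f)
  (∑-congᴬ (All.map (λ (_ , bnd) → ∑-insertEverywhere-above f-inv _ (All.map s≤s bnd)) (perms-Word n)))

-- Peak sets

≡ᵇ-refl : ∀ m → (m ≡ᵇ m) ≡ true
≡ᵇ-refl zero    = refl
≡ᵇ-refl (suc m) = ≡ᵇ-refl m

≡ᵇ-true⇒≡ : ∀ {m n} → (m ≡ᵇ n) ≡ true → m ≡ n
≡ᵇ-true⇒≡ {m} {n} e = ≡ᵇ⇒≡ m n (subst T (sym e) _)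

≢⇒≡ᵇ-false : ∀ {m n} → m ≢ n → (m ≡ᵇ n) ≡ false
≢⇒≡ᵇ-false {m} {n} m≢n with m ≡ᵇ n in e
... | true  = ⊥-elim (m≢n (≡ᵇ-true⇒≡ e))
... | false = refl

memb-++ : ∀ m X Y → memb m (X ++ Y) ≡ (memb m X ∨ memb m Y)
memb-++ m []      Y = refl
memb-++ m (x ∷ X) Y = trans (cong ((m ≡ᵇ x) ∨_) (memb-++ m X Y)) (sym (∨-assoc (m ≡ᵇ x) _ _))

memb-singleton : ∀ m x → memb m (x ∷ []) ≡ (m ≡ᵇ x)
memb-singleton m x = ∨-identityʳ (m ≡ᵇ x)

memb-if : ∀ m j c → memb m (if c then j ∷ [] else []) ≡ (c ∧ (m ≡ᵇ j))
memb-if m j true  = memb-singleton m j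
memb-if m j false = refl

_≃_ : List ℕ → List ℕ → Set
X ≃ Y = ∀ m → memb m X ≡ memb m Y

all-memb : ∀ p L → all p L ≡ true → ∀ {x} → memb x L ≡ true → p x ≡ true
all-memb p (y ∷ L) e {x} x∈ with p y in py | memb x L in x∈L | x ≡ᵇ y in x≡y
... | true | true  | _     = all-memb p L e x∈L
... | true | false | true  = subst (λ z → p z ≡ true) (sym (≡ᵇ-true⇒≡ x≡y)) py
... | true | false | false = ⊥-elim (false≢true x∈)
  where
  false≢true : false ≢ true
  false≢true ()

memb-all : ∀ p L → (∀ {x} → memb x L ≡ true → p x ≡ true) → all p L ≡ true
memb-all p []      h = refl
memb-all p (y ∷ L) h = cong₂ _∧_ (h (cong (_∨ memb y L) (≡ᵇ-refl y)))
                                 (memb-all p L (λ {x} x∈ → h (trans (cong ((x ≡ᵇ y) ∨_) x∈) (∨-zeroʳ _))))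

bool-ext : ∀ {a b : Bool} → (a ≡ true → b ≡ true) → (b ≡ true → a ≡ true) → a ≡ b
bool-ext {true}          f g = sym (f refl)
bool-ext {false} {true}  f g = g refl
bool-ext {false} {false} f g = refl

sameSetᵇ-sound : ∀ X Y → sameSetᵇ X Y ≡ true → X ≃ Y
sameSetᵇ-sound X Y e m with all (λ x → memb x Y) X in X⊆Y | all (λ x → memb x X) Y in Y⊆X
... | true | true = bool-ext (all-memb _ X X⊆Y) (all-memb _ Y Y⊆X)

sameSetᵇ-complete : ∀ X Y → X ≃ Y → sameSetᵇ X Y ≡ true
sameSetᵇ-complete X Y h =
  cong₂ _∧_ (memb-all _ X (λ {x} x∈ → trans (sym (h x)) x∈)) (memb-all _ Y (λ {x} x∈ → trans (h x) x∈))

-- whether i + 2 ∈ Peak w, i.e. whether w_{i+1} < w_{i+2} > w_{i+3}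
peakAt : List ℕ → ℕ → Bool
peakAt (_ ∷ w)        (suc i) = peakAt w i
peakAt (a ∷ b ∷ c ∷ _) zero    = (a <ᵇ b) ∧ (c <ᵇ b)
peakAt _              _       = false

peakAt-short : ∀ w i → length w ≤ suc (suc i) → peakAt w i ≡ false
peakAt-short (a ∷ w)         (suc i) (s≤s l)         = peakAt-short w i l
peakAt-short []              _       _               = refl
peakAt-short (a ∷ [])        zero    _               = refl
peakAt-short (a ∷ b ∷ [])    zero    _               = refl
peakAt-short (a ∷ b ∷ c ∷ w) zero    (s≤s (s≤s ()))

peakAt-++ˡ : ∀ σ τ i → suc (suc i) < length σ → peakAt (σ ++ τ) i ≡ peakAt σ i
peakAt-++ˡ (a ∷ σ)         τ (suc i) (s≤s l)             = peakAt-++ˡ σ τ i l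
peakAt-++ˡ (a ∷ b ∷ c ∷ σ) τ zero    _                   = refl
peakAt-++ˡ (a ∷ [])        τ zero    (s≤s ())
peakAt-++ˡ (a ∷ b ∷ [])    τ zero    (s≤s (s≤s ()))

peakAt-++ʳ : ∀ σ τ i → peakAt (σ ++ τ) (length σ + i) ≡ peakAt τ i
peakAt-++ʳ []      τ i = refl
peakAt-++ʳ (a ∷ σ) τ i = peakAt-++ʳ σ τ i

peakAt-adjacent : ∀ w i → (peakAt w i ∧ peakAt w (suc i)) ≡ false
peakAt-adjacent (a ∷ w)             (suc i) = peakAt-adjacent w i
peakAt-adjacent []                  _       = refl
peakAt-adjacent (a ∷ [])            zero    = refl
peakAt-adjacent (a ∷ b ∷ [])        zero    = refl
peakAt-adjacent (a ∷ b ∷ c ∷ [])    zero    = ∧-zeroʳ _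
peakAt-adjacent (a ∷ b ∷ c ∷ d ∷ w) zero with a <ᵇ b | c <ᵇ b in c<b | b <ᵇ c in b<c
... | false | _     | _     = refl
... | true  | false | _     = refl
... | true  | true  | false = refl
... | true  | true  | true  = ⊥-elim (<-asym (<ᵇ⇒< c b (subst T (sym c<b) _)) (<ᵇ⇒< b c (subst T (sym b<c) _)))

memb-peaksFrom-< : ∀ m j w → m < j → memb m (peaksFrom j w) ≡ false
memb-peaksFrom-< m j (a ∷ b ∷ c ∷ w) m<j =
  trans (memb-++ m (if C then j ∷ [] else []) _)
        (cong₂ _∨_ (trans (memb-if m j C) (trans (cong (C ∧_) (≢⇒≡ᵇ-false (<⇒≢ m<j))) (∧-zeroʳ C)))
                   (memb-peaksFrom-< m (suc j) (b ∷ c ∷ w) (m≤n⇒m≤1+n m<j)))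
  where C = (a <ᵇ b) ∧ (c <ᵇ b)
memb-peaksFrom-< m j []          _ = refl
memb-peaksFrom-< m j (a ∷ [])    _ = refl
memb-peaksFrom-< m j (a ∷ b ∷ []) _ = refl

memb-peaksFrom : ∀ i j w → memb (i + j) (peaksFrom j w) ≡ peakAt w i
memb-peaksFrom zero    j (a ∷ b ∷ c ∷ w) =
  trans (memb-++ j (if C then j ∷ [] else []) _)
        (trans (cong₂ _∨_ (trans (memb-if j j C) (trans (cong (C ∧_) (≡ᵇ-refl j)) (∧-identityʳ C)))
                          (memb-peaksFrom-< j (suc j) (b ∷ c ∷ w) ≤-refl))
               (∨-identityʳ C))
  where C = (a <ᵇ b) ∧ (c <ᵇ b)
memb-peaksFrom (suc i) j (a ∷ b ∷ c ∷ w) =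
  trans (memb-++ (suc i + j) (if C then j ∷ [] else []) _)
        (cong₂ _∨_ (trans (memb-if (suc i + j) j C) (trans (cong (C ∧_) (≢⇒≡ᵇ-false i+1+j≢j)) (∧-zeroʳ C)))
                   (trans (cong (λ z → memb z (peaksFrom (suc j) (b ∷ c ∷ w))) (sym (+-suc i j)))
                          (memb-peaksFrom i (suc j) (b ∷ c ∷ w))))
  where
  C = (a <ᵇ b) ∧ (c <ᵇ b)
  i+1+j≢j : suc i + j ≢ j
  i+1+j≢j e = <⇒≢ (m<n+m j z<s) (sym e)
memb-peaksFrom i j []           = sym (peakAt-short [] i z≤n)
memb-peaksFrom i j (a ∷ [])     = sym (peakAt-short (a ∷ []) i (s≤s z≤n))
memb-peaksFrom i j (a ∷ b ∷ []) = sym (peakAt-short (a ∷ b ∷ []) i (s≤s (s≤s z≤n)))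

isPeak : List ℕ → ℕ → Bool
isPeak w m = memb m (Peak w)

isPeak-0 : ∀ w → isPeak w 0 ≡ false
isPeak-0 w = memb-peaksFrom-< 0 2 w z<s

isPeak-1 : ∀ w → isPeak w 1 ≡ false
isPeak-1 w = memb-peaksFrom-< 1 2 w (s<s z<s)

isPeak-2+ : ∀ w i → isPeak w (suc (suc i)) ≡ peakAt w i
isPeak-2+ w i = trans (cong (λ m → memb m (Peak w)) (+-comm 2 i)) (memb-peaksFrom i 2 w)

isPeak-≥length : ∀ w m → length w ≤ m → isPeak w m ≡ false
isPeak-≥length w zero          _ = isPeak-0 w
isPeak-≥length w (suc zero)    _ = isPeak-1 w
isPeak-≥length w (suc (suc i)) l = trans (isPeak-2+ w i) (peakAt-short w i l)

isPeak-++ˡ : ∀ σ τ m → m < length σ → isPeak (σ ++ τ) m ≡ isPeak σ m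
isPeak-++ˡ σ τ zero          _ = trans (isPeak-0 (σ ++ τ)) (sym (isPeak-0 σ))
isPeak-++ˡ σ τ (suc zero)    _ = trans (isPeak-1 (σ ++ τ)) (sym (isPeak-1 σ))
isPeak-++ˡ σ τ (suc (suc i)) l = trans (isPeak-2+ (σ ++ τ) i) (trans (peakAt-++ˡ σ τ i l) (sym (isPeak-2+ σ i)))

isPeak-++ʳ : ∀ σ τ i → isPeak (σ ++ τ) (length σ + suc (suc i)) ≡ isPeak τ (suc (suc i))
isPeak-++ʳ σ τ i = begin
  isPeak (σ ++ τ) (length σ + suc (suc i))
    ≡⟨ cong (isPeak (σ ++ τ)) (trans (+-suc (length σ) (suc i)) (cong suc (+-suc (length σ) i))) ⟩
  isPeak (σ ++ τ) (suc (suc (length σ + i))) ≡⟨ isPeak-2+ (σ ++ τ) (length σ + i) ⟩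
  peakAt (σ ++ τ) (length σ + i)             ≡⟨ peakAt-++ʳ σ τ i ⟩
  peakAt τ i                                 ≡⟨ sym (isPeak-2+ τ i) ⟩
  isPeak τ (suc (suc i))                     ∎
  where open ≡-Reasoning

isPeak-adjacent : ∀ w m → (isPeak w m ∧ isPeak w (suc m)) ≡ false
isPeak-adjacent w zero          = cong (_∧ isPeak w 1) (isPeak-0 w)
isPeak-adjacent w (suc zero)    = cong (_∧ isPeak w 2) (isPeak-1 w)
isPeak-adjacent w (suc (suc i)) = trans (cong₂ _∧_ (isPeak-2+ w i) (isPeak-2+ w (suc i))) (peakAt-adjacent w i)

data Position (k : ℕ) : ℕ → Set where
  before : ∀ {m} → m < k → Position k m
  at₀    : Position k k
  at₁    : Position k (suc k)
  after  : ∀ i → Position k (k + suc (suc i))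

position : ∀ k m → Position k m
position zero    zero          = at₀
position zero    (suc zero)    = at₁
position zero    (suc (suc i)) = after i
position (suc k) zero          = before z<s
position (suc k) (suc m) with position k m
... | before m<k = before (s<s m<k)
... | at₀        = at₀
... | at₁        = at₁
... | after i    = after i

Peak-++-≃ : ∀ σ τ {k} → length σ ≡ k → ∀ S E →
  (∀ m → k ≤ m → memb m S ≡ false) → (∀ m → m ≢ k → m ≢ suc k → memb m E ≡ false) →
  Peak (σ ++ τ) ≃ (S ++ E) ⇔
  (Peak σ ≃ S × Peak τ ≃ [] × isPeak (σ ++ τ) k ≡ memb k E × isPeak (σ ++ τ) (suc k) ≡ memb (suc k) E)
Peak-++-≃ σ τ {k} refl S E S-beyond E-near = mk⇔ split join
  where
  π = σ ++ τ
  E-before : ∀ {m} → m < k → memb m E ≡ false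
  E-before m<k = E-near _ (<⇒≢ m<k) (<⇒≢ (m≤n⇒m≤1+n m<k))
  E-after : ∀ i → memb (k + suc (suc i)) E ≡ false
  E-after i = E-near _ (λ e → <⇒≢ (m<m+n k z<s) (sym e)) (λ e → <⇒≢ (subst (suc k <_) (sym (+-suc k (suc i))) (m<m+n (suc k) z<s)) (sym e))
  σ-beyond : ∀ m → k ≤ m → isPeak σ m ≡ memb m S
  σ-beyond m k≤m = trans (isPeak-≥length σ m k≤m) (sym (S-beyond m k≤m))
  S-after : ∀ i → memb (k + suc (suc i)) S ≡ false
  S-after i = S-beyond _ (m≤m+n k _)

  split : Peak π ≃ (S ++ E) →
    Peak σ ≃ S × Peak τ ≃ [] × isPeak π k ≡ memb k E × isPeak π (suc k) ≡ memb (suc k) E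
  split h = hσ , hτ , trans (h′ k) (cong (_∨ memb k E) (S-beyond k ≤-refl))
                    , trans (h′ (suc k)) (cong (_∨ memb (suc k) E) (S-beyond (suc k) (n≤1+n k)))
    where
    h′ : ∀ m → isPeak π m ≡ (memb m S ∨ memb m E)
    h′ m = trans (h m) (memb-++ m S E)
    hσ : Peak σ ≃ S
    hσ m with position k m
    ... | before m<k = trans (sym (isPeak-++ˡ σ τ m m<k))
                             (trans (h′ m) (trans (cong (memb m S ∨_) (E-before m<k)) (∨-identityʳ _)))
    ... | at₀        = σ-beyond m ≤-refl
    ... | at₁        = σ-beyond m (n≤1+n k)
    ... | after i    = σ-beyond m (m≤m+n k _)
    hτ : Peak τ ≃ []
    hτ zero          = isPeak-0 τ
    hτ (suc zero)    = isPeak-1 τ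
    hτ (suc (suc i)) = trans (sym (isPeak-++ʳ σ τ i)) (trans (h′ _) (cong₂ _∨_ (S-after i) (E-after i)))

  join : Peak σ ≃ S × Peak τ ≃ [] × isPeak π k ≡ memb k E × isPeak π (suc k) ≡ memb (suc k) E →
    Peak π ≃ (S ++ E)
  join (hσ , hτ , e₀ , e₁) m = trans (at m (position k m)) (sym (memb-++ m S E))
    where
    at : ∀ m → Position k m → isPeak π m ≡ (memb m S ∨ memb m E)
    at m (before m<k) = trans (isPeak-++ˡ σ τ m m<k)
                              (trans (hσ m) (sym (trans (cong (memb m S ∨_) (E-before m<k)) (∨-identityʳ _))))
    at _ at₀          = trans e₀ (cong (_∨ memb k E) (sym (S-beyond k ≤-refl)))
    at _ at₁          = trans e₁ (cong (_∨ memb (suc k) E) (sym (S-beyond (suc k) (n≤1+n k))))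
    at _ (after i)    = trans (isPeak-++ʳ σ τ i) (trans (hτ _) (sym (cong₂ _∨_ (S-after i) (E-after i))))

∧-≡true : ∀ {a b} → (a ∧ b) ≡ true → a ≡ true × b ≡ true
∧-≡true {true} {true} _ = refl , refl

sameSetᵇ-Peak-++ : ∀ σ τ {k} → length σ ≡ k → ∀ S E →
  (∀ m → k ≤ m → memb m S ≡ false) → (∀ m → m ≢ k → m ≢ suc k → memb m E ≡ false) →
  isPeak (σ ++ τ) k ≡ memb k E → isPeak (σ ++ τ) (suc k) ≡ memb (suc k) E →
  sameSetᵇ (Peak (σ ++ τ)) (S ++ E) ≡ (sameSetᵇ (Peak σ) S ∧ sameSetᵇ (Peak τ) [])
sameSetᵇ-Peak-++ σ τ |σ| S E S-beyond E-near e₀ e₁ = bool-ext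
  (λ c → let (hσ , hτ , _) = Equivalence.to decomposition (sameSetᵇ-sound (Peak (σ ++ τ)) (S ++ E) c)
         in cong₂ _∧_ (sameSetᵇ-complete (Peak σ) S hσ) (sameSetᵇ-complete (Peak τ) [] hτ))
  (λ d → let (dσ , dτ) = ∧-≡true d
         in sameSetᵇ-complete (Peak (σ ++ τ)) (S ++ E)
              (Equivalence.from decomposition (sameSetᵇ-sound (Peak σ) S dσ , sameSetᵇ-sound (Peak τ) [] dτ , e₀ , e₁)))
  where decomposition = Peak-++-≃ σ τ |σ| S E S-beyond E-near

sameSetᵇ-Peak-++-mismatch : ∀ σ τ {k} → length σ ≡ k → ∀ S E →
  (∀ m → k ≤ m → memb m S ≡ false) → (∀ m → m ≢ k → m ≢ suc k → memb m E ≡ false) →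
  (isPeak (σ ++ τ) k ≡ memb k E → isPeak (σ ++ τ) (suc k) ≡ memb (suc k) E → ⊥) →
  sameSetᵇ (Peak (σ ++ τ)) (S ++ E) ≡ false
sameSetᵇ-Peak-++-mismatch σ τ |σ| S E S-beyond E-near mismatch with sameSetᵇ (Peak (σ ++ τ)) (S ++ E) in c
... | false = refl
... | true  = let (_ , _ , e₀ , e₁) = Equivalence.to (Peak-++-≃ σ τ |σ| S E S-beyond E-near)
                                                      (sameSetᵇ-sound (Peak (σ ++ τ)) (S ++ E) c)
              in ⊥-elim (mismatch e₀ e₁)

hasPeak : List ℕ → Bool
hasPeak (a ∷ b ∷ c ∷ w) = ((a <ᵇ b) ∧ (c <ᵇ b)) ∨ hasPeak (b ∷ c ∷ w)
hasPeak _               = false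

peaksFrom≃[] : ∀ j w → sameSetᵇ (peaksFrom j w) [] ≡ not (hasPeak w)
peaksFrom≃[] j (a ∷ b ∷ c ∷ w) = prepend ((a <ᵇ b) ∧ (c <ᵇ b)) (peaksFrom≃[] (suc j) (b ∷ c ∷ w))
  where
  prepend : ∀ {P h} c → sameSetᵇ P [] ≡ not h → sameSetᵇ ((if c then j ∷ [] else []) ++ P) [] ≡ not (c ∨ h)
  prepend true  _ = refl
  prepend false e = e
peaksFrom≃[] j []          = refl
peaksFrom≃[] j (a ∷ [])    = refl
peaksFrom≃[] j (a ∷ b ∷ []) = refl

hasPeak-∷ : ∀ a v → hasPeak v ≡ true → hasPeak (a ∷ v) ≡ true
hasPeak-∷ a (b ∷ c ∷ d ∷ w) h = trans (cong (((a <ᵇ b) ∧ (c <ᵇ b)) ∨_) h) (∨-zeroʳ _)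

hasPeak-max-∷ : ∀ {x} b u → b < x → hasPeak (x ∷ b ∷ u) ≡ hasPeak (b ∷ u)
hasPeak-max-∷ b []      _   = refl
hasPeak-max-∷ b (c ∷ u) b<x rewrite ≥⇒<ᵇ≡false (<⇒≤ b<x) = refl

hasPeak-∷ʳ-max : ∀ {x} w → All (_< x) w → hasPeak (w ++ x ∷ []) ≡ hasPeak w
hasPeak-∷ʳ-max []              _              = refl
hasPeak-∷ʳ-max (a ∷ [])        _              = refl
hasPeak-∷ʳ-max (a ∷ b ∷ [])    (_ ∷ b<x ∷ []) rewrite ≥⇒<ᵇ≡false (<⇒≤ b<x) = trans (∨-identityʳ _) (∧-zeroʳ (a <ᵇ b))
hasPeak-∷ʳ-max (a ∷ b ∷ c ∷ w) (_ ∷ w<x)      = cong (((a <ᵇ b) ∧ (c <ᵇ b)) ∨_) (hasPeak-∷ʳ-max (b ∷ c ∷ w) w<x)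

insertInterior : ℕ → List ℕ → List (List ℕ)
insertInterior x []      = []
insertInterior x (b ∷ u) = (x ∷ b ∷ u) ∷ map (b ∷_) (insertInterior x u)

insertEverywhere-∷ʳ : ∀ x u → insertEverywhere x u ≡ insertInterior x u ++ (u ++ x ∷ []) ∷ []
insertEverywhere-∷ʳ x []      = refl
insertEverywhere-∷ʳ x (b ∷ u) =
  cong ((x ∷ b ∷ u) ∷_) (trans (cong (map (b ∷_)) (insertEverywhere-∷ʳ x u)) (map-++ (b ∷_) (insertInterior x u) _))

insertInterior-hasPeak : ∀ {a x} → a < x → ∀ u → All (_< x) u → All (λ w → hasPeak (a ∷ w) ≡ true) (insertInterior x u)
insertInterior-hasPeak a<x []      []         = []
insertInterior-hasPeak {a} {x} a<x (b ∷ u) (b<x ∷ u<x) =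
  cong₂ (λ s t → (s ∧ t) ∨ hasPeak (x ∷ b ∷ u)) (<⇒<ᵇ≡true a<x) (<⇒<ᵇ≡true b<x)
  ∷ map⁺ (All.map (λ {w} → hasPeak-∷ a (b ∷ w)) (insertInterior-hasPeak b<x u u<x))

inv-∷ʳ-max : ∀ {x} w → All (_< x) w → inv (w ++ x ∷ []) ≡ inv w
inv-∷ʳ-max {x} w w<x = trans (inv-++ w (x ∷ [])) (trans (cong (_+ (inv w + 0)) (crossInv-max w w<x)) (+-identityʳ (inv w)))
  where
  crossInv-max : ∀ w → All (_< x) w → crossInv w (x ∷ []) ≡ 0
  crossInv-max []      []         = refl
  crossInv-max (a ∷ w) (a<x ∷ w<x) rewrite ≥⇒<ᵇ≡false (<⇒≤ a<x) = crossInv-max w w<x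

-- q-binomial coefficients and shuffles

module _ (q : ℕ) where

  -- [n k]_q through the q-Pascal recursion
  qbin : ℕ → ℕ → ℕ
  qbin n       zero    = 1
  qbin zero    (suc k) = 0
  qbin (suc n) (suc k) = q ^ (n ∸ k) * qbin n k + qbin n (suc k)

  qbin-> : ∀ n k → n < k → qbin n k ≡ 0
  qbin-> zero    (suc k) _       = refl
  qbin-> (suc n) (suc k) (s≤s p) rewrite qbin-> n k p | qbin-> n (suc k) (m≤n⇒m≤1+n p) =
    trans (+-identityʳ _) (*-zeroʳ (q ^ (n ∸ k)))

  qbin-diag : ∀ n → qbin n n ≡ 1
  qbin-diag zero    = refl
  qbin-diag (suc n) rewrite n∸n≡0 n | qbin-diag n | qbin-> n (suc n) ≤-refl = refl

  qint-+ : ∀ a b → qint q (a + b) ≡ qint q a + q ^ a * qint q b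
  qint-+ zero    b = sym (+-identityʳ _)
  qint-+ (suc a) b = begin
    1 + q * qint q (a + b)                 ≡⟨ cong (λ z → 1 + q * z) (qint-+ a b) ⟩
    1 + q * (qint q a + q ^ a * qint q b)  ≡⟨ distribute q (qint q a) (q ^ a) (qint q b) ⟩
    (1 + q * qint q a) + q * q ^ a * qint q b ∎
    where
    open ≡-Reasoning
    distribute : ∀ p x y z → 1 + p * (x + y * z) ≡ (1 + p * x) + p * y * z
    distribute = solve-∀

  qfact-qbin : ∀ n k → k ≤ n → qfact q n ≡ qbin n k * (qfact q k * qfact q (n ∸ k))
  qfact-qbin n       zero    _         = sym (trans (*-identityˡ _) (+-identityʳ _))
  qfact-qbin (suc n) (suc k) (s≤s k≤n) with m≤n⇒m<n∨m≡n k≤n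
  ... | inj₂ refl = sym (trans (cong₂ (λ c l → c * (qfact q (suc k) * qfact q l)) (qbin-diag (suc k)) (n∸n≡0 k))
                               (trans (*-identityˡ _) (*-identityʳ _)))
  ... | inj₁ k<n  = begin
    qint q (suc n) * N                 ≡⟨ cong (λ l → qint q l * N) (sym 1+n≡[1+d]+[1+k]) ⟩
    qint q (suc d + suc k) * N         ≡⟨ cong (_* N) (qint-+ (suc d) (suc k)) ⟩
    (B + Q * A) * N                    ≡⟨ *-distribʳ-+ N B (Q * A) ⟩
    B * N + Q * A * N                  ≡⟨ cong₂ (λ x y → B * x + Q * A * y) (qfact-qbin n (suc k) k<n) ih ⟩
    B * (c₂ * ((A * Fk) * Fd)) + Q * A * (c₁ * (Fk * (B * Fd)))
                                       ≡⟨ collect B Q A c₁ c₂ Fk Fd ⟩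
    (Q * c₁ + c₂) * ((A * Fk) * (B * Fd)) ≡⟨ cong (λ l → (q ^ l * c₁ + c₂) * ((A * Fk) * qfact q l)) (sym n∸k≡1+d) ⟩
    (q ^ (n ∸ k) * c₁ + c₂) * ((A * Fk) * qfact q (n ∸ k)) ∎
    where
    open ≡-Reasoning
    d  = n ∸ suc k
    N  = qfact q n
    A  = qint q (suc k)
    B  = qint q (suc d)
    Q  = q ^ suc d
    Fk = qfact q k
    Fd = qfact q d
    c₁ = qbin n k
    c₂ = qbin n (suc k)
    n∸k≡1+d : n ∸ k ≡ suc d
    n∸k≡1+d = +-∸-assoc 1 k<n
    1+n≡[1+d]+[1+k] : suc d + suc k ≡ suc n
    1+n≡[1+d]+[1+k] = trans (+-suc (suc d) k) (cong suc (trans (cong (_+ k) (sym n∸k≡1+d)) (m∸n+n≡m k≤n)))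
    ih : N ≡ c₁ * (Fk * (B * Fd))
    ih = trans (qfact-qbin n k k≤n) (cong (λ l → c₁ * (Fk * qfact q l)) n∸k≡1+d)
    collect : ∀ B Q A c₁ c₂ Fk Fd → B * (c₂ * ((A * Fk) * Fd)) + Q * A * (c₁ * (Fk * (B * Fd)))
                                    ≡ (Q * c₁ + c₂) * ((A * Fk) * (B * Fd))
    collect = solve-∀

  qbinom≡qbin : ∀ n k → k ≤ n → qbinom q n k ≡ qbin n k
  qbinom≡qbin n k k≤n =
    trans (cong (λ z → (z / (qfact q k * qfact q (n ∸ k))) {{nonZero}}) (qfact-qbin n k k≤n))
          (m*n/n≡m (qbin n k) (qfact q k * qfact q (n ∸ k)) {{nonZero}})
    where
    nonZero : NonZero (qfact q k * qfact q (n ∸ k))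
    nonZero = m*n≢0 (qfact q k) (qfact q (n ∸ k)) {{qfact-nz q k}} {{qfact-nz q (n ∸ k)}}

  glue : (List ℕ → ℕ) → (List ℕ → ℕ) → List ℕ → List ℕ → ℕ
  glue f g u v = q ^ crossInv u v * (f u * g v)

  splitWeight : ℕ → (List ℕ → ℕ) → (List ℕ → ℕ) → List ℕ → ℕ
  splitWeight k f g π = glue f g (take k π) (drop k π)

  splitWeight-++ : ∀ {k} f g u v → length u ≡ k → splitWeight k f g (u ++ v) ≡ glue f g u v
  splitWeight-++ f g u v refl = cong₂ (glue f g) (take-++ u v) (drop-++ u v)

  ∑-insert-glueˡ : ∀ f g x u v → All (_< x) v →
    ∑ (insertEverywhere x u) (λ w → glue f g w v) ≡ q ^ length v * glue (λ _ → ∑ (insertEverywhere x u) f) g u v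
  ∑-insert-glueˡ f g x u v v<x = begin
    ∑ (insertEverywhere x u) (λ w → glue f g w v)
      ≡⟨ ∑-congᴬ (All.map at (crossInv-insertEverywhereˡ x u v)) ⟩
    ∑ (insertEverywhere x u) (λ w → (q ^ length v * q ^ crossInv u v * g v) * f w)
      ≡⟨ ∑-*ˡ (insertEverywhere x u) (q ^ length v * q ^ crossInv u v * g v) f ⟩
    (q ^ length v * q ^ crossInv u v * g v) * ∑ (insertEverywhere x u) f
      ≡⟨ regroup (q ^ length v) (q ^ crossInv u v) (g v) _ ⟩
    q ^ length v * glue (λ _ → ∑ (insertEverywhere x u) f) g u v ∎
    where
    open ≡-Reasoning
    regroup : ∀ a b c d → (a * b * c) * d ≡ a * (b * (d * c))
    regroup = solve-∀
    reorder : ∀ a b c d → a * b * (c * d) ≡ (a * b * d) * c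
    reorder = solve-∀
    at : ∀ {w} → crossInv w v ≡ below x v + crossInv u v →
         glue f g w v ≡ (q ^ length v * q ^ crossInv u v * g v) * f w
    at {w} e = begin
      q ^ crossInv w v * (f w * g v)                      ≡⟨ cong (λ z → q ^ z * (f w * g v)) (trans e (cong (_+ crossInv u v) (below≡length v v<x))) ⟩
      q ^ (length v + crossInv u v) * (f w * g v)         ≡⟨ cong (_* (f w * g v)) (^-distribˡ-+-* q (length v) (crossInv u v)) ⟩
      q ^ length v * q ^ crossInv u v * (f w * g v)       ≡⟨ reorder (q ^ length v) (q ^ crossInv u v) (f w) (g v) ⟩
      (q ^ length v * q ^ crossInv u v * g v) * f w       ∎

  ∑-insert-glueʳ : ∀ f g x u ρ → All (_< x) u →
    ∑ (insertEverywhere x ρ) (λ w → glue f g u w) ≡ glue f (λ _ → ∑ (insertEverywhere x ρ) g) u ρ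
  ∑-insert-glueʳ f g x u ρ u<x = begin
    ∑ (insertEverywhere x ρ) (λ w → glue f g u w)
      ≡⟨ ∑-congᴬ (All.map at (crossInv-insertEverywhereʳ u u<x ρ)) ⟩
    ∑ (insertEverywhere x ρ) (λ w → (q ^ crossInv u ρ * f u) * g w)
      ≡⟨ ∑-*ˡ (insertEverywhere x ρ) (q ^ crossInv u ρ * f u) g ⟩
    (q ^ crossInv u ρ * f u) * ∑ (insertEverywhere x ρ) g
      ≡⟨ *-assoc (q ^ crossInv u ρ) (f u) _ ⟩
    glue f (λ _ → ∑ (insertEverywhere x ρ) g) u ρ ∎
    where
    open ≡-Reasoning
    at : ∀ {w} → crossInv u w ≡ crossInv u ρ → glue f g u w ≡ (q ^ crossInv u ρ * f u) * g w
    at {w} e = trans (cong (λ z → q ^ z * (f u * g w)) e) (sym (*-assoc (q ^ crossInv u ρ) (f u) (g w)))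

  -- The new largest letter lands either among the first k + 1 letters, where it is inverted with every later
  -- letter, or among the others, where it changes no inversion across the split.
  ∑-insertMax-splitWeight : ∀ {m k} f g → OrderInvariant f → OrderInvariant g → ∀ u y ρ →
    length u ≡ k → All (_≤ m) (u ++ y ∷ ρ) →
    ∑ (insertEverywhere (suc m) (u ++ y ∷ ρ)) (splitWeight (suc k) f g)
      ≡ q ^ length (y ∷ ρ) * splitWeight k (liftMax f) g (u ++ y ∷ ρ) + splitWeight (suc k) f (liftMax g) (u ++ y ∷ ρ)
  ∑-insertMax-splitWeight {m} {k} f g f-inv g-inv u y ρ |u| π≤m = begin
    ∑ (insertEverywhere x (u ++ y ∷ ρ)) (splitWeight (suc k) f g)
      ≡⟨ cong (λ ws → ∑ ws (splitWeight (suc k) f g)) (insertEverywhere-++ x u y ρ) ⟩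
    ∑ (map (_++ y ∷ ρ) (insertEverywhere x u) ++ map (uy ++_) (insertEverywhere x ρ)) (splitWeight (suc k) f g)
      ≡⟨ ∑-++ (map (_++ y ∷ ρ) (insertEverywhere x u)) _ _ ⟩
    ∑ (map (_++ y ∷ ρ) (insertEverywhere x u)) (splitWeight (suc k) f g)
      + ∑ (map (uy ++_) (insertEverywhere x ρ)) (splitWeight (suc k) f g)
      ≡⟨ cong₂ _+_ (trans (∑-map (_++ y ∷ ρ) (insertEverywhere x u) _) (∑-congᴬ (All.map
                      (λ {w} |w| → splitWeight-++ f g w (y ∷ ρ) (trans |w| (cong suc |u|))) (insertEverywhere-length x u))))
                   (trans (∑-map (uy ++_) (insertEverywhere x ρ) _) (∑-cong (insertEverywhere x ρ)
                      (λ w → splitWeight-++ f g uy w |uy|))) ⟩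
    ∑ (insertEverywhere x u) (λ w → glue f g w (y ∷ ρ)) + ∑ (insertEverywhere x ρ) (glue f g uy)
      ≡⟨ cong₂ _+_ (∑-insert-glueˡ f g x u (y ∷ ρ) (++⁻ʳ u π<x)) (∑-insert-glueʳ f g x uy ρ (++⁻ˡ uy uyρ<x)) ⟩
    q ^ length (y ∷ ρ) * glue (λ _ → ∑ (insertEverywhere x u) f) g u (y ∷ ρ)
      + glue f (λ _ → ∑ (insertEverywhere x ρ) g) uy ρ
      ≡⟨ cong₂ (λ a b → q ^ length (y ∷ ρ) * (q ^ crossInv u (y ∷ ρ) * (a * g (y ∷ ρ))) + q ^ crossInv uy ρ * (f uy * b))
               (∑-insertEverywhere-above f-inv u (++⁻ˡ u π<x)) (∑-insertEverywhere-above g-inv ρ (++⁻ʳ uy uyρ<x)) ⟩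
    q ^ length (y ∷ ρ) * glue (liftMax f) g u (y ∷ ρ) + glue f (liftMax g) uy ρ
      ≡⟨ sym (cong₂ (λ a b → q ^ length (y ∷ ρ) * a + b) (splitWeight-++ (liftMax f) g u (y ∷ ρ) |u|)
                    (trans (cong (splitWeight (suc k) f (liftMax g)) assoc) (splitWeight-++ f (liftMax g) uy ρ |uy|))) ⟩
    q ^ length (y ∷ ρ) * splitWeight k (liftMax f) g (u ++ y ∷ ρ) + splitWeight (suc k) f (liftMax g) (u ++ y ∷ ρ) ∎
    where
    open ≡-Reasoning
    x  = suc m
    uy = u ++ y ∷ []
    assoc : u ++ y ∷ ρ ≡ uy ++ ρ
    assoc = sym (++-assoc u (y ∷ []) ρ)
    |uy| : length uy ≡ suc k
    |uy| = trans (length-++ u) (trans (+-comm (length u) 1) (cong suc |u|))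
    π<x : All (_< x) (u ++ y ∷ ρ)
    π<x = All.map s≤s π≤m
    uyρ<x : All (_< x) (uy ++ ρ)
    uyρ<x = subst (All (_< x)) assoc π<x

  ∑-insertMax-splitWeight-Word : ∀ {m k} f g → OrderInvariant f → OrderInvariant g → k < m → ∀ {π} → Word m π →
    ∑ (insertEverywhere (suc m) π) (splitWeight (suc k) f g)
      ≡ q ^ (m ∸ k) * splitWeight k (liftMax f) g π + splitWeight (suc k) f (liftMax g) π
  ∑-insertMax-splitWeight-Word {m} {k} f g f-inv g-inv k<m {π} (|π| , π≤m) = split (drop k π) refl
    where
    |drop| : length (drop k π) ≡ m ∸ k
    |drop| = trans (length-drop k π) (cong (_∸ k) |π|)
    |take| : length (take k π) ≡ k
    |take| = trans (length-take k π) (m≤n⇒m⊓n≡m (≤-trans (<⇒≤ k<m) (≤-reflexive (sym |π|))))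
    split : ∀ v → drop k π ≡ v →
      ∑ (insertEverywhere (suc m) π) (splitWeight (suc k) f g)
        ≡ q ^ (m ∸ k) * splitWeight k (liftMax f) g π + splitWeight (suc k) f (liftMax g) π
    split []      e = ⊥-elim (<⇒≢ (m<n⇒0<n∸m k<m) (trans (cong length (sym e)) |drop|))
    split (y ∷ ρ) e =
      subst (λ σ → ∑ (insertEverywhere (suc m) σ) (splitWeight (suc k) f g)
                     ≡ q ^ (m ∸ k) * splitWeight k (liftMax f) g σ + splitWeight (suc k) f (liftMax g) σ)
            π≡
            (subst (λ l → ∑ (insertEverywhere (suc m) (take k π ++ y ∷ ρ)) (splitWeight (suc k) f g)
                            ≡ q ^ l * splitWeight k (liftMax f) g (take k π ++ y ∷ ρ)
                              + splitWeight (suc k) f (liftMax g) (take k π ++ y ∷ ρ))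
                   (trans (cong length (sym e)) |drop|)
                   (∑-insertMax-splitWeight f g f-inv g-inv (take k π) y ρ |take| (subst (All (_≤ m)) (sym π≡) π≤m)))
      where
      π≡ : take k π ++ y ∷ ρ ≡ π
      π≡ = trans (cong (take k π ++_) (sym e)) (take++drop≡id k π)

  ∑-splitWeight-0 : ∀ n f g → ∑ (perms n) (splitWeight 0 f g) ≡ qbin n 0 * (∑ (perms 0) f * ∑ (perms n) g)
  ∑-splitWeight-0 n f g = begin
    ∑ (perms n) (λ π → 1 * (f [] * g π)) ≡⟨ ∑-cong (perms n) (λ π → *-identityˡ _) ⟩
    ∑ (perms n) (λ π → f [] * g π)       ≡⟨ ∑-*ˡ (perms n) (f []) g ⟩
    f [] * ∑ (perms n) g                 ≡⟨ sym (trans (*-identityˡ _) (cong (_* ∑ (perms n) g) (+-identityʳ (f [])))) ⟩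
    1 * ((f [] + 0) * ∑ (perms n) g)     ∎
    where open ≡-Reasoning

  ∑-splitWeight-full : ∀ n f g → ∑ (perms n) (splitWeight n f g) ≡ qbin n n * (∑ (perms n) f * ∑ (perms (n ∸ n)) g)
  ∑-splitWeight-full n f g = begin
    ∑ (perms n) (splitWeight n f g)      ≡⟨ ∑-congᴬ (All.map whole (perms-Word n)) ⟩
    ∑ (perms n) (λ π → g [] * f π)       ≡⟨ ∑-*ˡ (perms n) (g []) f ⟩
    g [] * ∑ (perms n) f                 ≡⟨ *-comm (g []) _ ⟩
    ∑ (perms n) f * g []                 ≡⟨ cong (λ z → ∑ (perms n) f * z) (sym (+-identityʳ (g []))) ⟩
    ∑ (perms n) f * ∑ (perms 0) g        ≡⟨ sym (trans (cong₂ (λ a b → a * (∑ (perms n) f * ∑ (perms b) g)) (qbin-diag n) (n∸n≡0 n)) (*-identityˡ _)) ⟩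
    qbin n n * (∑ (perms n) f * ∑ (perms (n ∸ n)) g) ∎
    where
    open ≡-Reasoning
    whole : ∀ {π} → Word n π → splitWeight n f g π ≡ g [] * f π
    whole {π} (|π| , _) = begin
      splitWeight n f g π             ≡⟨ cong (splitWeight n f g) (sym (++-identityʳ π)) ⟩
      splitWeight n f g (π ++ [])     ≡⟨ splitWeight-++ f g π [] |π| ⟩
      q ^ crossInv π [] * (f π * g []) ≡⟨ cong (λ z → q ^ z * (f π * g [])) (crossInv-[] π) ⟩
      1 * (f π * g [])                ≡⟨ trans (*-identityˡ _) (*-comm (f π) (g [])) ⟩
      g [] * f π                      ∎

  ∑-splitWeight : ∀ n k → k ≤ n → ∀ f g → OrderInvariant f → OrderInvariant g →
    ∑ (perms n) (splitWeight k f g) ≡ qbin n k * (∑ (perms k) f * ∑ (perms (n ∸ k)) g)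
  ∑-splitWeight n       zero    _         f g _     _     = ∑-splitWeight-0 n f g
  ∑-splitWeight (suc m) (suc k) (s≤s k≤m) f g f-inv g-inv with m≤n⇒m<n∨m≡n k≤m
  ... | inj₂ refl = ∑-splitWeight-full (suc k) f g
  ... | inj₁ k<m  = begin
    ∑ (perms (suc m)) (splitWeight (suc k) f g)
      ≡⟨ ∑-concatMap (insertEverywhere (suc m)) (perms m) _ ⟩
    ∑ (perms m) (λ π → ∑ (insertEverywhere (suc m) π) (splitWeight (suc k) f g))
      ≡⟨ ∑-congᴬ (All.map (∑-insertMax-splitWeight-Word f g f-inv g-inv k<m) (perms-Word m)) ⟩
    ∑ (perms m) (λ π → q ^ (m ∸ k) * splitWeight k (liftMax f) g π + splitWeight (suc k) f (liftMax g) π)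
      ≡⟨ trans (∑-distrib-+ (perms m) _ _) (cong (_+ ∑ (perms m) (splitWeight (suc k) f (liftMax g))) (∑-*ˡ (perms m) (q ^ (m ∸ k)) _)) ⟩
    q ^ (m ∸ k) * ∑ (perms m) (splitWeight k (liftMax f) g) + ∑ (perms m) (splitWeight (suc k) f (liftMax g))
      ≡⟨ cong₂ (λ a b → q ^ (m ∸ k) * a + b)
               (∑-splitWeight m k k≤m (liftMax f) g (liftMax-invariant f-inv) g-inv)
               (∑-splitWeight m (suc k) k<m f (liftMax g) f-inv (liftMax-invariant g-inv)) ⟩
    q ^ (m ∸ k) * (qbin m k * (∑ (perms k) (liftMax f) * G)) + qbin m (suc k) * (F * ∑ (perms (m ∸ suc k)) (liftMax g))
      ≡⟨ cong₂ (λ a b → q ^ (m ∸ k) * (qbin m k * (a * G)) + qbin m (suc k) * (F * b))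
               (sym (∑-perms-suc k f f-inv))
               (trans (sym (∑-perms-suc (m ∸ suc k) g g-inv)) (cong (λ l → ∑ (perms l) g) (sym m∸k≡1+m∸1+k))) ⟩
    q ^ (m ∸ k) * (qbin m k * (F * G)) + qbin m (suc k) * (F * G)
      ≡⟨ factor (q ^ (m ∸ k)) (qbin m k) F G (qbin m (suc k)) ⟩
    qbin (suc m) (suc k) * (F * G) ∎
    where
    open ≡-Reasoning
    F = ∑ (perms (suc k)) f
    G = ∑ (perms (m ∸ k)) g
    m∸k≡1+m∸1+k : m ∸ k ≡ suc (m ∸ suc k)
    m∸k≡1+m∸1+k = +-∸-assoc 1 k<m
    factor : ∀ a b c d e → a * (b * (c * d)) + e * (c * d) ≡ (a * b + e) * (c * d)
    factor = solve-∀

  -- Weights of peak sets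

  weight : List ℕ → List ℕ → ℕ
  weight S π = if sameSetᵇ (Peak π) S then q ^ inv π else 0

  weight-invariant : ∀ S → OrderInvariant (weight S)
  weight-invariant S r = cong₂ (λ X i → if sameSetᵇ X S then q ^ i else 0) (peaksFrom-≅ r 2) (inv-≅ r)

  peaklessWeight : List ℕ → ℕ
  peaklessWeight w = if hasPeak w then 0 else q ^ inv w

  weight-[] : ∀ w → weight [] w ≡ peaklessWeight w
  weight-[] w = trans (cong (λ c → if c then q ^ inv w else 0) (peaksFrom≃[] 2 w)) (unfold (hasPeak w))
    where
    unfold : ∀ h → (if not h then q ^ inv w else 0) ≡ (if h then 0 else q ^ inv w)
    unfold true  = refl
    unfold false = refl

  -- a new largest letter adds no peak at the ends (and q^(m+1) inversions at the front), and a peak anywhere else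
  ∑-insertMax-peakless : ∀ m {τ} → Word (suc m) τ →
    ∑ (insertEverywhere (suc (suc m)) τ) peaklessWeight ≡ peaklessWeight τ * (1 + q ^ suc m)
  ∑-insertMax-peakless m {b ∷ u} (|τ| , b≤ ∷ u≤) = begin
    peaklessWeight (x ∷ τ) + ∑ (map (b ∷_) (insertEverywhere x u)) peaklessWeight
      ≡⟨ cong (λ ws → peaklessWeight (x ∷ τ) + ∑ ws peaklessWeight)
              (trans (cong (map (b ∷_)) (insertEverywhere-∷ʳ x u)) (map-++ (b ∷_) (insertInterior x u) _)) ⟩
    peaklessWeight (x ∷ τ) + ∑ (map (b ∷_) (insertInterior x u) ++ (τ ++ x ∷ []) ∷ []) peaklessWeight
      ≡⟨ cong (peaklessWeight (x ∷ τ) +_) (∑-++ (map (b ∷_) (insertInterior x u)) _ peaklessWeight) ⟩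
    peaklessWeight (x ∷ τ) + (∑ (map (b ∷_) (insertInterior x u)) peaklessWeight + (peaklessWeight (τ ++ x ∷ []) + 0))
      ≡⟨ cong₂ (λ a c → a + (c + (peaklessWeight (τ ++ x ∷ []) + 0))) front interior ⟩
    q ^ suc m * peaklessWeight τ + (0 + (peaklessWeight (τ ++ x ∷ []) + 0))
      ≡⟨ cong (λ c → q ^ suc m * peaklessWeight τ + (0 + (c + 0))) back ⟩
    q ^ suc m * peaklessWeight τ + (0 + (peaklessWeight τ + 0))
      ≡⟨ collect (q ^ suc m) (peaklessWeight τ) ⟩
    peaklessWeight τ * (1 + q ^ suc m) ∎
    where
    open ≡-Reasoning
    x = suc (suc m)
    τ = b ∷ u
    τ<x : All (_< x) τ
    τ<x = All.map s≤s (b≤ ∷ u≤)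
    collect : ∀ a c → a * c + (0 + (c + 0)) ≡ c * (1 + a)
    collect = solve-∀
    front : peaklessWeight (x ∷ τ) ≡ q ^ suc m * peaklessWeight τ
    front = begin
      (if hasPeak (x ∷ τ) then 0 else q ^ inv (x ∷ τ))
        ≡⟨ cong₂ (λ h i → if h then 0 else q ^ i) (hasPeak-max-∷ b u (s≤s b≤))
                 (trans (inv-∷ x τ) (cong (_+ inv τ) (trans (below≡length τ τ<x) |τ|))) ⟩
      (if hasPeak τ then 0 else q ^ (suc m + inv τ))
        ≡⟨ cong (λ z → if hasPeak τ then 0 else z) (^-distribˡ-+-* q (suc m) (inv τ)) ⟩
      (if hasPeak τ then 0 else q ^ suc m * q ^ inv τ)
        ≡⟨ pull (hasPeak τ) ⟩
      q ^ suc m * peaklessWeight τ ∎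
      where
      pull : ∀ h → (if h then 0 else q ^ suc m * q ^ inv τ) ≡ q ^ suc m * (if h then 0 else q ^ inv τ)
      pull true  = sym (*-zeroʳ (q ^ suc m))
      pull false = refl
    interior : ∑ (map (b ∷_) (insertInterior x u)) peaklessWeight ≡ 0
    interior = trans (∑-map (b ∷_) (insertInterior x u) peaklessWeight)
      (∑-zero _ (All.map (λ {w} h → cong (λ z → if z then 0 else q ^ inv (b ∷ w)) h)
                         (insertInterior-hasPeak (s≤s b≤) u (All.map s≤s u≤))))
    back : peaklessWeight (τ ++ x ∷ []) ≡ peaklessWeight τ
    back = cong₂ (λ h i → if h then 0 else q ^ i) (hasPeak-∷ʳ-max τ τ<x) (inv-∷ʳ-max τ τ<x)

  ∑-peakless : ∀ m → ∑ (perms m) (weight []) ≡ negqPoch q (m ∸ 1)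
  ∑-peakless zero    = refl
  ∑-peakless (suc m) = trans (∑-cong (perms (suc m)) weight-[]) (count m)
    where
    count : ∀ m → ∑ (perms (suc m)) peaklessWeight ≡ negqPoch q m
    count zero    = refl
    count (suc m) = begin
      ∑ (perms (suc (suc m))) peaklessWeight
        ≡⟨ ∑-concatMap (insertEverywhere (suc (suc m))) (perms (suc m)) peaklessWeight ⟩
      ∑ (perms (suc m)) (λ τ → ∑ (insertEverywhere (suc (suc m)) τ) peaklessWeight)
        ≡⟨ ∑-congᴬ (All.map (∑-insertMax-peakless m) (perms-Word (suc m))) ⟩
      ∑ (perms (suc m)) (λ τ → peaklessWeight τ * (1 + q ^ suc m))
        ≡⟨ ∑-cong (perms (suc m)) (λ τ → *-comm (peaklessWeight τ) _) ⟩
      ∑ (perms (suc m)) (λ τ → (1 + q ^ suc m) * peaklessWeight τ)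
        ≡⟨ ∑-*ˡ (perms (suc m)) (1 + q ^ suc m) peaklessWeight ⟩
      (1 + q ^ suc m) * ∑ (perms (suc m)) peaklessWeight
        ≡⟨ trans (*-comm (1 + q ^ suc m) _) (cong (_* (1 + q ^ suc m)) (count m)) ⟩
      negqPoch q (suc m) ∎
      where open ≡-Reasoning

  glue-weight : ∀ S T σ τ →
    glue (weight S) (weight T) σ τ ≡ (if sameSetᵇ (Peak σ) S ∧ sameSetᵇ (Peak τ) T then q ^ inv (σ ++ τ) else 0)
  glue-weight S T σ τ with sameSetᵇ (Peak σ) S | sameSetᵇ (Peak τ) T
  ... | true  | true  = begin
    q ^ crossInv σ τ * (q ^ inv σ * q ^ inv τ) ≡⟨ cong (q ^ crossInv σ τ *_) (sym (^-distribˡ-+-* q (inv σ) (inv τ))) ⟩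
    q ^ crossInv σ τ * q ^ (inv σ + inv τ)     ≡⟨ sym (^-distribˡ-+-* q (crossInv σ τ) _) ⟩
    q ^ (crossInv σ τ + (inv σ + inv τ))       ≡⟨ cong (q ^_) (sym (inv-++ σ τ)) ⟩
    q ^ inv (σ ++ τ)                           ∎
    where open ≡-Reasoning
  ... | true  | false = trans (cong (q ^ crossInv σ τ *_) (*-zeroʳ (q ^ inv σ))) (*-zeroʳ (q ^ crossInv σ τ))
  ... | false | _     = *-zeroʳ (q ^ crossInv σ τ)

  -- The three peak sets differ only at the boundary positions k and k + 1, which are never both peaks;
  -- whichever of them are peaks of σ ++ τ selects the one summand that survives.
  weight-boundary : ∀ S {k} σ τ → length σ ≡ k → (∀ m → k ≤ m → memb m S ≡ false) →
    weight (S ++ suc k ∷ []) (σ ++ τ) + weight S (σ ++ τ) + weight (S ++ k ∷ []) (σ ++ τ)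
      ≡ glue (weight S) (weight []) σ τ
  weight-boundary S {k} σ τ |σ| S-beyond = by-boundary (isPeak π k) (isPeak π (suc k)) refl refl
    where
    π  = σ ++ τ
    E₀ = k ∷ []
    E₊ = suc k ∷ []
    D  = sameSetᵇ (Peak σ) S ∧ sameSetᵇ (Peak τ) []
    ite : Bool → ℕ
    ite c = if c then q ^ inv π else 0
    summands : ∀ {c₊ c∅ c₀} → sameSetᵇ (Peak π) (S ++ E₊) ≡ c₊ → sameSetᵇ (Peak π) (S ++ []) ≡ c∅ →
      sameSetᵇ (Peak π) (S ++ E₀) ≡ c₀ → weight (S ++ E₊) π + weight S π + weight (S ++ E₀) π ≡ ite c₊ + ite c∅ + ite c₀
    summands e₊ e∅ e₀ = cong₂ _+_ (cong₂ _+_ (cong ite e₊) (cong ite (trans (cong (sameSetᵇ (Peak π)) (sym (++-identityʳ S))) e∅)))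
                                  (cong ite e₀)
    matches : ∀ E → (∀ m → m ≢ k → m ≢ suc k → memb m E ≡ false) →
      isPeak π k ≡ memb k E → isPeak π (suc k) ≡ memb (suc k) E → sameSetᵇ (Peak π) (S ++ E) ≡ D
    matches E = sameSetᵇ-Peak-++ σ τ |σ| S E S-beyond
    mismatch : ∀ E → (∀ m → m ≢ k → m ≢ suc k → memb m E ≡ false) →
      (isPeak π k ≡ memb k E → isPeak π (suc k) ≡ memb (suc k) E → ⊥) → sameSetᵇ (Peak π) (S ++ E) ≡ false
    mismatch E = sameSetᵇ-Peak-++-mismatch σ τ |σ| S E S-beyond
    memb-self : ∀ m → memb m (m ∷ []) ≡ true
    memb-self m = trans (memb-singleton m m) (≡ᵇ-refl m)
    k∉E₊ : memb k E₊ ≡ false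
    k∉E₊ = trans (memb-singleton k (suc k)) (≢⇒≡ᵇ-false (<⇒≢ (n<1+n k)))
    k+1∉E₀ : memb (suc k) E₀ ≡ false
    k+1∉E₀ = trans (memb-singleton (suc k) k) (≢⇒≡ᵇ-false (λ e → <⇒≢ (n<1+n k) (sym e)))
    near∅ : ∀ m → m ≢ k → m ≢ suc k → memb m [] ≡ false
    near∅ _ _ _ = refl
    near₀ : ∀ m → m ≢ k → m ≢ suc k → memb m E₀ ≡ false
    near₀ m m≢k _ = trans (memb-singleton m k) (≢⇒≡ᵇ-false m≢k)
    near₊ : ∀ m → m ≢ k → m ≢ suc k → memb m E₊ ≡ false
    near₊ m _ m≢k+1 = trans (memb-singleton m (suc k)) (≢⇒≡ᵇ-false m≢k+1)
    disagree : ∀ {b} → b ≡ true → b ≡ false → ⊥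
    disagree refl ()
    by-boundary : ∀ b₀ b₁ → isPeak π k ≡ b₀ → isPeak π (suc k) ≡ b₁ →
      weight (S ++ E₊) π + weight S π + weight (S ++ E₀) π ≡ glue (weight S) (weight []) σ τ
    by-boundary true  true  p₀ p₁ = ⊥-elim (disagree (cong₂ _∧_ p₀ p₁) (isPeak-adjacent π k))
    by-boundary false false p₀ p₁ =
      trans (summands (mismatch E₊ near₊ λ _ e → disagree (trans e (memb-self (suc k))) p₁)
                      (matches [] near∅ p₀ p₁)
                      (mismatch E₀ near₀ λ e _ → disagree (trans e (memb-self k)) p₀))
            (trans (+-identityʳ (ite D)) (sym (glue-weight S [] σ τ)))
    by-boundary true  false p₀ p₁ =
      trans (summands (mismatch E₊ near₊ λ _ e → disagree (trans e (memb-self (suc k))) p₁)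
                      (mismatch [] near∅ λ e _ → disagree p₀ e)
                      (matches E₀ near₀ (trans p₀ (sym (memb-self k))) (trans p₁ (sym k+1∉E₀))))
            (sym (glue-weight S [] σ τ))
    by-boundary false true  p₀ p₁ =
      trans (summands (matches E₊ near₊ (trans p₀ (sym k∉E₊)) (trans p₁ (sym (memb-self (suc k)))))
                      (mismatch [] near∅ λ _ e → disagree p₁ e)
                      (mismatch E₀ near₀ λ e _ → disagree (trans e (memb-self k)) p₀))
            (trans (+-identityʳ (ite D + 0)) (trans (+-identityʳ (ite D)) (sym (glue-weight S [] σ τ))))

  peak-recursion : ∀ n k S → k ≤ n → (∀ m → k ≤ m → memb m S ≡ false) →
    P (S ++ suc k ∷ []) n q + P S n q + P (S ++ k ∷ []) n q ≡ qbinom q n k * P S k q * negqPoch q (n ∸ k ∸ 1)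
  peak-recursion n k S k≤n S-beyond = begin
    ∑ (perms n) (weight (S ++ suc k ∷ [])) + ∑ (perms n) (weight S) + ∑ (perms n) (weight (S ++ k ∷ []))
      ≡⟨ sym (trans (∑-distrib-+ (perms n) _ (weight (S ++ k ∷ [])))
                    (cong (_+ ∑ (perms n) (weight (S ++ k ∷ []))) (∑-distrib-+ (perms n) (weight (S ++ suc k ∷ [])) (weight S)))) ⟩
    ∑ (perms n) (λ π → weight (S ++ suc k ∷ []) π + weight S π + weight (S ++ k ∷ []) π)
      ≡⟨ ∑-congᴬ (All.map boundary (perms-Word n)) ⟩
    ∑ (perms n) (splitWeight k (weight S) (weight []))
      ≡⟨ ∑-splitWeight n k k≤n (weight S) (weight []) (weight-invariant S) (weight-invariant []) ⟩
    qbin n k * (P S k q * ∑ (perms (n ∸ k)) (weight []))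
      ≡⟨ cong₂ (λ a b → a * (P S k q * b)) (sym (qbinom≡qbin n k k≤n)) (∑-peakless (n ∸ k)) ⟩
    qbinom q n k * (P S k q * negqPoch q (n ∸ k ∸ 1))
      ≡⟨ sym (*-assoc (qbinom q n k) _ _) ⟩
    qbinom q n k * P S k q * negqPoch q (n ∸ k ∸ 1) ∎
    where
    open ≡-Reasoning
    boundary : ∀ {π} → Word n π →
      weight (S ++ suc k ∷ []) π + weight S π + weight (S ++ k ∷ []) π ≡ splitWeight k (weight S) (weight []) π
    boundary {π} (|π| , _) =
      subst (λ ρ → weight (S ++ suc k ∷ []) ρ + weight S ρ + weight (S ++ k ∷ []) ρ ≡ splitWeight k (weight S) (weight []) ρ)
            (take++drop≡id k π)
            (trans (weight-boundary S (take k π) (drop k π) |take| S-beyond)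
                   (sym (splitWeight-++ (weight S) (weight []) (take k π) (drop k π) |take|)))
      where
      |take| : length (take k π) ≡ k
      |take| = trans (length-take k π) (m≤n⇒m⊓n≡m (≤-trans k≤n (≤-reflexive (sym |π|))))

Linked-∷ʳ⇒< : ∀ {xs s m} → Linked _<_ (xs ++ s ∷ []) → memb m xs ≡ true → m < s
Linked-∷ʳ⇒< {x ∷ xs} {s} {m} linked m∈ with m ≡ᵇ x in m≡x
... | true  = subst (_< s) (sym (≡ᵇ-true⇒≡ m≡x)) (head< x xs linked)
  where
  head< : ∀ x xs → Linked _<_ (x ∷ xs ++ s ∷ []) → x < s
  head< x []       (x<s ∷ [-])   = x<s
  head< x (y ∷ xs) (x<y ∷ rest) = <-trans x<y (head< y xs rest)
... | false = Linked-∷ʳ⇒< (Linked.tail linked) m∈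

lemma3p6 : (n : ℕ) → 1 ≤ n → (S₁ : List ℕ) → (s : ℕ) →
    Linked _<_ (S₁ ++ s ∷ []) → Admissible n (S₁ ++ s ∷ []) →
    (q : ℕ) →
    let k = s ∸ 1
        S₂ = S₁ ++ k ∷ []
    in P (S₁ ++ s ∷ []) n q + P S₁ n q + P S₂ n q
       ≡ qbinom q n k * P S₁ k q * negqPoch q (n ∸ k ∸ 1)
lemma3p6 n _ S₁ s linked (admissible π π∈ peaks) q = recursion s refl
  where
  peak : ∀ {m} → memb m (S₁ ++ s ∷ []) ≡ true → isPeak π m ≡ true
  peak {m} m∈ = trans (sameSetᵇ-sound (Peak π) (S₁ ++ s ∷ []) peaks m) m∈
  s-peak : isPeak π s ≡ true
  s-peak = peak (trans (memb-++ s S₁ (s ∷ [])) (trans (cong (memb s S₁ ∨_) (trans (memb-singleton s s) (≡ᵇ-refl s))) (∨-zeroʳ _)))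
  S₁-peak : ∀ {m} → memb m S₁ ≡ true → isPeak π m ≡ true
  S₁-peak {m} m∈ = peak (trans (memb-++ m S₁ (s ∷ [])) (cong (_∨ memb m (s ∷ [])) m∈))
  disagree : ∀ {b} → b ≡ true → b ≡ false → ⊥
  disagree refl ()
  recursion : ∀ t → t ≡ s →
    P (S₁ ++ s ∷ []) n q + P S₁ n q + P (S₁ ++ (t ∸ 1) ∷ []) n q ≡ qbinom q n (t ∸ 1) * P S₁ (t ∸ 1) q * negqPoch q (n ∸ (t ∸ 1) ∸ 1)
  recursion zero    refl = ⊥-elim (disagree s-peak (isPeak-0 π))
  recursion (suc k) refl = peak-recursion q n k S₁ k≤n S₁-beyond
    where
    k<n : suc k < n
    k<n = ≰⇒> (λ n≤s → disagree s-peak (isPeak-≥length π s (≤-trans (≤-reflexive (proj₁ (All.lookup (perms-Word n) π∈))) n≤s)))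
    k≤n : k ≤ n
    k≤n = ≤-trans (n≤1+n k) (<⇒≤ k<n)
    S₁-beyond : ∀ m → k ≤ m → memb m S₁ ≡ false
    S₁-beyond m k≤m with memb m S₁ in m∈
    ... | false = refl
    ... | true  with m≤n⇒m<n∨m≡n k≤m
    ...   | inj₁ k<m  = ⊥-elim (<⇒≱ (Linked-∷ʳ⇒< linked m∈) k<m)
    ...   | inj₂ refl = ⊥-elim (disagree (cong₂ _∧_ (S₁-peak m∈) s-peak) (isPeak-adjacent π k))
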